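{- Let $\mathcal Q$ be a quantale and $I_1,I_2$ quantic conuclei on $\mathcal Q$ with $I_1\le I_2$ pointwise. If $I_2$ is unital (respectively central, respectively strongly square increasing), then $I_1$ is unital (respectively central, respectively strongly square increasing). (For the unital case $\mathcal Q$ is assumed unital.)
   Context: A quantale is a complete join-semilattice with an associative multiplication distributing over arbitrary joins on both sides; unital if it has a unit $\varepsilon$. A quantic conucleus is a map $I$ with $Ia\le a$, $I(Ia)=Ia$, $a\le b\Rightarrow Ia\le Ib$, and $Ia\cdot Ib=I(Ia\cdot Ib)$. $I_1\le I_2$ means $I_1a\le I_2a$ for all $a$. A conucleus $I$ is central if $Ia\cdot b=b\cdot Ia$ for all $a,b$; strongly square increasing if $Ia\cdot b\le Ia\cdot b\cdot Ia$ and $b\cdot Ia\le Ia\cdot b\cdot Ia$ for all $a,b$; unital if $Ia\le\varepsilon$ for all $a$. -}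

module Defs where

open import Level using (Level; suc; _⊔_)
open import Relation.Binary.Bundles using (Poset)
open import Data.Product using (_×_)

-- A quantale: a complete join-semilattice (a poset with joins of all
-- families indexed by types in Set c; since the carrier lives in Set c this
-- covers arbitrary subsets) with an associative multiplication that
-- distributes over arbitrary joins on both sides.
record Quantale (c ℓ₁ ℓ₂ : Level) : Set (suc (c ⊔ ℓ₁ ⊔ ℓ₂)) where
  field
    poset : Poset c ℓ₁ ℓ₂
  open Poset poset public
  infixl 7 _·_
  field
    ⋁       : {I : Set c} → (I → Carrier) → Carrier
    ⋁-upper : {I : Set c} (f : I → Carrier) (i : I) → f i ≤ ⋁ f
    ⋁-least : {I : Set c} (f : I → Carrier) (b : Carrier) →
              (∀ i → f i ≤ b) → ⋁ f ≤ b
    _·_     : Carrier → Carrier → Carrier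
    ·-cong  : ∀ {a a′ b b′} → a ≈ a′ → b ≈ b′ → a · b ≈ a′ · b′
    ·-assoc : ∀ a b c → (a · b) · c ≈ a · (b · c)
    ·-distribˡ-⋁ : ∀ a {I : Set c} (f : I → Carrier) → a · ⋁ f ≈ ⋁ (λ i → a · f i)
    ·-distribʳ-⋁ : ∀ a {I : Set c} (f : I → Carrier) → ⋁ f · a ≈ ⋁ (λ i → f i · a)

module _ {c ℓ₁ ℓ₂} (Q : Quantale c ℓ₁ ℓ₂) where
  open Quantale Q

  IsUnit : Carrier → Set (c ⊔ ℓ₁)
  IsUnit ε = ∀ a → (ε · a ≈ a) × (a · ε ≈ a)

  record IsQuanticConucleus (I : Carrier → Carrier) : Set (c ⊔ ℓ₁ ⊔ ℓ₂) where
    field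
      deflationary : ∀ a → I a ≤ a
      idempotent   : ∀ a → I (I a) ≈ I a
      monotone     : ∀ {a b} → a ≤ b → I a ≤ I b
      closed-·     : ∀ a b → I a · I b ≈ I (I a · I b)

  _≤ᶜ_ : (Carrier → Carrier) → (Carrier → Carrier) → Set (c ⊔ ℓ₂)
  I₁ ≤ᶜ I₂ = ∀ a → I₁ a ≤ I₂ a

  IsCentral : (Carrier → Carrier) → Set (c ⊔ ℓ₁)
  IsCentral I = ∀ a b → I a · b ≈ b · I a

  IsStronglySquareIncreasing : (Carrier → Carrier) → Set (c ⊔ ℓ₂)
  IsStronglySquareIncreasing I =
    ∀ a b → (I a · b ≤ I a · b · I a) × (b · I a ≤ I a · b · I a)

  IsUnitalConucleus : Carrier → (Carrier → Carrier) → Set (c ⊔ ℓ₂)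
  IsUnitalConucleus ε I = ∀ a → I a ≤ ε

{-# OPTIONS --safe #-}
module Submission where

open import Level using (_⊔_)
open import Defs
open import Data.Product using (_×_; _,_; ∃)
import Relation.Binary.Reasoning.PartialOrder as ≤-Reasoning

-- Each of the three properties constrains a conucleus only through its image, and
-- I₁ ≤ I₂ forces the image of I₁ into the image of I₂: indeed I₂ fixes every I₁ a,
-- since I₁ a ≈ I₁ (I₁ a) ≤ I₂ (I₁ a) ≤ I₁ a.

module _ {c ℓ₁ ℓ₂} (Q : Quantale c ℓ₁ ℓ₂) where
  open Quantale Q
  open ≤-Reasoning poset

  _⊆ᵢ_ : (Carrier → Carrier) → (Carrier → Carrier) → Set (c ⊔ ℓ₁)
  I₁ ⊆ᵢ I₂ = ∀ a → ∃ λ b → I₁ a ≈ I₂ b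

  ≤ᶜ⇒⊆ᵢ : ∀ {I₁ I₂} → IsQuanticConucleus Q I₁ → IsQuanticConucleus Q I₂ →
          _≤ᶜ_ Q I₁ I₂ → I₁ ⊆ᵢ I₂
  ≤ᶜ⇒⊆ᵢ {I₁} {I₂} C₁ C₂ I₁≤I₂ a = I₁ a , Eq.sym I₂-fixes-I₁a
    where
    open IsQuanticConucleus
    I₂-fixes-I₁a : I₂ (I₁ a) ≈ I₁ a
    I₂-fixes-I₁a = antisym (deflationary C₂ (I₁ a)) (begin
      I₁ a        ≈⟨ Eq.sym (idempotent C₁ a) ⟩
      I₁ (I₁ a)   ≤⟨ I₁≤I₂ (I₁ a) ⟩
      I₂ (I₁ a)   ∎)

  isUnitalConucleus-⊆ᵢ : ∀ {ε I₁ I₂} → I₁ ⊆ᵢ I₂ →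
                         IsUnitalConucleus Q ε I₂ → IsUnitalConucleus Q ε I₁
  isUnitalConucleus-⊆ᵢ {ε} {I₁} {I₂} I₁⊆I₂ unital a with I₁⊆I₂ a
  ... | b , I₁a≈I₂b = begin
    I₁ a  ≈⟨ I₁a≈I₂b ⟩
    I₂ b  ≤⟨ unital b ⟩
    ε     ∎

  isCentral-⊆ᵢ : ∀ {I₁ I₂} → I₁ ⊆ᵢ I₂ → IsCentral Q I₂ → IsCentral Q I₁
  isCentral-⊆ᵢ {I₁} {I₂} I₁⊆I₂ central a x with I₁⊆I₂ a
  ... | b , I₁a≈I₂b = begin-equality
    I₁ a · x  ≈⟨ ·-cong I₁a≈I₂b Eq.refl ⟩
    I₂ b · x  ≈⟨ central b x ⟩
    x · I₂ b  ≈⟨ ·-cong Eq.refl (Eq.sym I₁a≈I₂b) ⟩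
    x · I₁ a  ∎

  isStronglySquareIncreasing-⊆ᵢ : ∀ {I₁ I₂} → I₁ ⊆ᵢ I₂ →
    IsStronglySquareIncreasing Q I₂ → IsStronglySquareIncreasing Q I₁
  isStronglySquareIncreasing-⊆ᵢ {I₁} {I₂} I₁⊆I₂ ssi a x with I₁⊆I₂ a
  ... | b , I₁a≈I₂b with ssi b x
  ...   | left , right = (begin
      I₁ a · x           ≈⟨ ·-cong I₁a≈I₂b Eq.refl ⟩
      I₂ b · x           ≤⟨ left ⟩
      I₂ b · x · I₂ b    ≈⟨ square ⟩
      I₁ a · x · I₁ a    ∎)
    , (begin
      x · I₁ a           ≈⟨ ·-cong Eq.refl I₁a≈I₂b ⟩
      x · I₂ b           ≤⟨ right ⟩
      I₂ b · x · I₂ b    ≈⟨ square ⟩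
      I₁ a · x · I₁ a    ∎)
    where
    square : I₂ b · x · I₂ b ≈ I₁ a · x · I₁ a
    square = Eq.sym (·-cong (·-cong I₁a≈I₂b Eq.refl) I₁a≈I₂b)

mainTheorem14 : ∀ {c ℓ₁ ℓ₂} (Q : Quantale c ℓ₁ ℓ₂) (I₁ I₂ : Quantale.Carrier Q → Quantale.Carrier Q) →
    IsQuanticConucleus Q I₁ → IsQuanticConucleus Q I₂ → _≤ᶜ_ Q I₁ I₂ →
    ((ε : Quantale.Carrier Q) → IsUnit Q ε → IsUnitalConucleus Q ε I₂ → IsUnitalConucleus Q ε I₁)
    × (IsCentral Q I₂ → IsCentral Q I₁)
    × (IsStronglySquareIncreasing Q I₂ → IsStronglySquareIncreasing Q I₁)
mainTheorem14 Q I₁ I₂ C₁ C₂ I₁≤I₂ =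
    (λ _ _ → isUnitalConucleus-⊆ᵢ Q I₁⊆I₂)
  , isCentral-⊆ᵢ Q I₁⊆I₂
  , isStronglySquareIncreasing-⊆ᵢ Q I₁⊆I₂
  where
  I₁⊆I₂ : _⊆ᵢ_ Q I₁ I₂
  I₁⊆I₂ = ≤ᶜ⇒⊆ᵢ Q C₁ C₂ I₁≤I₂
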